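{- For every integer $n\ge0$ let $g_n\in\{0,1\}$ be the parity of the number of digits equal to $1$ in the negabinary representation of $n$ (the unique representation $n=\sum_{i\ge0}d_i(-2)^i$ with $d_i\in\{0,1\}$). For $k\ge0$ let $G_k$ be the finite word $g_0g_1\cdots g_{2^k-1}$ (the first $2^k$ terms). Then $G_0=0$, and: (i) for every even $k\ge 0$, $G_{k+1}=G_kF_k$ (concatenation), where $F_k$ is obtained from $G_k$ by complementing every term (replacing $0$ by $1$ and $1$ by $0$); (ii) for every odd $k\ge 1$, $G_{k+1}=G_kH_k$, where $H_k$ is obtained from $G_k$ by complementing its last $\tfrac{2}{3}(2^{k-1}-1)$ terms and leaving the other terms unchanged. -}

module Defs where

open import Data.Nat using (ℕ; zero; suc; _+_; _*_; _∸_; _^_; _/_; _%_)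
open import Data.Integer as ℤ using (ℤ; +_; -[1+_])
open import Data.Bool using (Bool; true; false; not; _xor_)
open import Data.List using (List; []; _∷_; length; take; drop; map; _++_; applyUpTo)

-- Negabinary digit expansion of an integer (least significant digit first),
-- computed by the standard algorithm  z = d + (-2) * z',  d = z mod 2 ∈ {0,1}.
-- Digits are Booleans (true = 1).  A fuel argument ensures termination;
-- 'negabinary n' uses fuel n + 1, which is more than enough for n ≥ 0
-- (the absolute value at least roughly halves at each step).
-- Step on naturals/integers:
--   +  n        : d = n % 2, z' = -(n ∸ d)/2  = -[ (n / 2) ]
--   -[1+ m ]    (value -(m+1)) : d = (m+1) % 2, z' = ((m+1) + d)/2
isOne : ℕ → Bool
isOne zero    = false
isOne (suc _) = true

nbDigits : ℕ → ℤ → List Bool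
nbDigits zero    _          = []
nbDigits (suc f) (+ zero)   = []
nbDigits (suc f) (+ suc n)  =
  let k = suc n in
  isOne (k % 2) ∷ nbDigits f (ℤ.- (+ (k / 2)))
nbDigits (suc f) -[1+ m ]   =
  let k = suc m in
  isOne (k % 2) ∷ nbDigits f (+ ((k + k % 2) / 2))

negabinary : ℕ → List Bool
negabinary n = nbDigits (suc n) (+ n)

nbValue : List Bool → ℤ
nbValue []          = + 0
nbValue (d ∷ ds)    = (if d then + 1 else + 0) ℤ.+ (ℤ.- (+ 2)) ℤ.* nbValue ds
  where open import Data.Bool using (if_then_else_)

parityOnes : List Bool → Bool
parityOnes []       = false
parityOnes (d ∷ ds) = d xor parityOnes ds

g : ℕ → Bool
g n = parityOnes (negabinary n)

G : ℕ → List Bool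
G k = applyUpTo g (2 ^ k)

complement : List Bool → List Bool
complement = map not

complementLast : ℕ → List Bool → List Bool
complementLast j w = take (length w ∸ j) w ++ complement (drop (length w ∸ j) w)

-- Write p(z) for the parity of the ones in the negabinary expansion of z ∈ ℤ.
-- Splitting off the lowest digit gives p(−2y) = p(y) and p(1 − 2y) = ¬ p(y).
-- Splitting off two digits of n = r + 4q gives g(n) = e(r) ⊕ g(⌊(n + 2)/4⌋),
-- with e depending only on r; since ⌊(4N + i + 2)/4⌋ = N + ⌊(i + 2)/4⌋, a
-- relation g(N + j) = b ⊕ g(j) on a range of j lifts to g(4N + i) = b ⊕ g(i)
-- for every i with ⌊(i + 2)/4⌋ in that range.  Lifting g(1 + i) = ¬ g(i)
-- (i ≤ 1), g(2 + i) = g(i) (i ≤ 1) and g(4) = ¬ g(2) m times gives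
-- g(4^m + i) = ¬ g(i) for i ≤ 4^m, and g(2·4^m + i) = g(i) exactly up to
-- i = (4^(m+1) − 1)/3, which leaves the last 2(4^m − 1)/3 terms complemented.

module Submission where

open import Defs
open import Data.Bool using (Bool; true; false; not; _xor_)
open import Data.Bool.Properties using (not-involutive)
open import Data.Integer as ℤ using (ℤ; +_; -[1+_])
open import Data.Integer.Properties using (pos-+; pos-*)
open import Data.Integer.Tactic.RingSolver using (solve-∀)
open import Data.List using ([]; _∷_; _++_; take; drop; length; applyUpTo)
open import Data.List.Properties using (length-applyUpTo; map-applyUpTo)
open import Data.Nat as ℕ using (ℕ; zero; suc; NonZero; _+_; _*_; _∸_; _^_; _/_; _%_; _≤_; _<_; z≤n; s≤s; z<s; s<s)
open import Data.Nat.Divisibility using (n∣m*n)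
open import Data.Nat.DivMod using (m≡m%n+[m/n]*n; m/n≡1+[m∸n]/n; m/n≤m; m/n<m; /-monoˡ-≤; m%n<n; m*n%n≡0; m*n/n≡m; [m+kn]%n≡m%n; +-distrib-/-∣ʳ)
open import Data.Nat.Properties using (≤-refl; ≤-reflexive; ≤-trans; ≤-pred; <⇒≤; +-monoʳ-≤; +-monoʳ-<; +-comm; +-suc; +-identityʳ; *-comm; *-assoc; m≤m+n; m+n∸n≡m; ^-*-assoc; module ≤-Reasoning)
open import Data.Nat.Tactic.RingSolver renaming (solve-∀ to solve-∀ℕ)
open import Data.Product using (_×_; _,_)
open import Relation.Binary.PropositionalEquality using (_≡_; refl; sym; trans; cong; cong₂; subst; module ≡-Reasoning)

-- nbDigits f z is independent of f ≥ digitBound z.  The bound is ∣ z ∣ + 1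
-- except at 0 and 1; it is tight along the run 2 ↦ -1 ↦ 1 ↦ 0.
digitBound : ℤ → ℕ
digitBound (+ zero)          = 0
digitBound (+ suc zero)      = 1
digitBound (+ suc (suc n))   = 3 + n
digitBound -[1+ m ]          = 2 + m

digitBound-+≤ : ∀ n → digitBound (+ n) ≤ suc n
digitBound-+≤ zero          = z≤n
digitBound-+≤ (suc zero)    = s≤s z≤n
digitBound-+≤ (suc (suc n)) = ≤-refl

2+n/2≡1+n/2 : ∀ n → (2 + n) / 2 ≡ suc (n / 2)
2+n/2≡1+n/2 n = m/n≡1+[m∸n]/n {2 + n} (s≤s (s≤s z≤n))

digitBound-next⁺ : ∀ n {f} → digitBound (+ suc n) ≤ suc f →
                   digitBound (ℤ.- (+ (suc n / 2))) ≤ f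
digitBound-next⁺ zero    _         = z≤n
digitBound-next⁺ (suc n) (s≤s le) rewrite 2+n/2≡1+n/2 n =
  ≤-trans (s≤s (s≤s (m/n≤m n 2))) le

digitBound-next⁻ : ∀ m {f} → digitBound -[1+ m ] ≤ suc f →
                   digitBound (+ ((suc m + suc m % 2) / 2)) ≤ f
digitBound-next⁻ zero    (s≤s le) = le
digitBound-next⁻ (suc m) (s≤s le) =
  ≤-trans (digitBound-+≤ _) (≤-trans (s≤s half≤) le)
  where
  k = 2 + m
  half≤ : (k + k % 2) / 2 ≤ suc m
  half≤ = begin
    (k + k % 2) / 2   ≤⟨ /-monoˡ-≤ 2 (+-monoʳ-≤ k (≤-pred (m%n<n k 2))) ⟩
    (k + 1) / 2       ≡⟨ cong (_/ 2) (+-comm k 1) ⟩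
    (2 + suc m) / 2   ≡⟨ 2+n/2≡1+n/2 (suc m) ⟩
    suc (suc m / 2)   ≤⟨ m/n<m (suc m) 2 (s≤s (s≤s z≤n)) ⟩
    suc m             ∎
    where open ≤-Reasoning

nbDigits-fuel : ∀ {f f′} z → digitBound z ≤ f → digitBound z ≤ f′ →
                nbDigits f z ≡ nbDigits f′ z
nbDigits-fuel {zero}  {zero}   _          _  _  = refl
nbDigits-fuel {zero}  {suc _}  (+ zero)   _  _  = refl
nbDigits-fuel {suc _} {zero}   (+ zero)   _  _  = refl
nbDigits-fuel {suc _} {suc _}  (+ zero)   _  _  = refl
nbDigits-fuel {suc _} {suc _}  (+ suc n)  le le′ =
  cong (_ ∷_) (nbDigits-fuel _ (digitBound-next⁺ n le) (digitBound-next⁺ n le′))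
nbDigits-fuel {suc _} {suc _}  -[1+ m ]   le le′ =
  cong (_ ∷_) (nbDigits-fuel _ (digitBound-next⁻ m le) (digitBound-next⁻ m le′))
nbDigits-fuel {zero}  {suc _}  (+ suc zero)      () _
nbDigits-fuel {zero}  {suc _}  (+ suc (suc _))   () _
nbDigits-fuel {zero}  {suc _}  -[1+ _ ]          () _
nbDigits-fuel {suc _} {zero}   (+ suc zero)      _ ()
nbDigits-fuel {suc _} {zero}   (+ suc (suc _))   _ ()
nbDigits-fuel {suc _} {zero}   -[1+ _ ]          _ ()

nbParity : ℤ → Bool
nbParity z = parityOnes (nbDigits (digitBound z) z)

nbParity-fuel : ∀ z {f} → digitBound z ≤ f → parityOnes (nbDigits f z) ≡ nbParity z
nbParity-fuel z le = cong parityOnes (nbDigits-fuel z le ≤-refl)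

g≡nbParity : ∀ n → g n ≡ nbParity (+ n)
g≡nbParity n = nbParity-fuel (+ n) (digitBound-+≤ n)

nbParity-step⁺ : ∀ k .{{_ : NonZero k}} →
                 nbParity (+ k) ≡ isOne (k % 2) xor nbParity (ℤ.- + (k / 2))
nbParity-step⁺ (suc n) = trans (sym (nbParity-fuel (+ suc n) (digitBound-+≤ (suc n))))
  (cong (isOne (suc n % 2) xor_)
        (nbParity-fuel (ℤ.- + (suc n / 2)) (digitBound-next⁺ n (digitBound-+≤ (suc n)))))

nbParity-step⁻ : ∀ k .{{_ : NonZero k}} → nbParity (ℤ.- + k) ≡
                 isOne (k % 2) xor nbParity (+ ((k + k % 2) / 2))
nbParity-step⁻ (suc m) = cong (isOne (suc m % 2) xor_)
  (nbParity-fuel (+ ((suc m + suc m % 2) / 2)) (digitBound-next⁻ m ≤-refl))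

[2*n]%2≡0 : ∀ n → 2 * n % 2 ≡ 0
[2*n]%2≡0 n = trans (cong (_% 2) (*-comm 2 n)) (m*n%n≡0 n 2)

[2*n]/2≡n : ∀ n → 2 * n / 2 ≡ n
[2*n]/2≡n n = trans (cong (_/ 2) (*-comm 2 n)) (m*n/n≡m n 2)

[1+2*n]%2≡1 : ∀ n → suc (2 * n) % 2 ≡ 1
[1+2*n]%2≡1 n = trans (cong (λ m → suc m % 2) (*-comm 2 n)) ([m+kn]%n≡m%n 1 n 2)

[1+2*n]/2≡n : ∀ n → suc (2 * n) / 2 ≡ n
[1+2*n]/2≡n n = begin
  (1 + 2 * n) / 2     ≡⟨ cong (λ m → (1 + m) / 2) (*-comm 2 n) ⟩
  (1 + n * 2) / 2     ≡⟨ +-distrib-/-∣ʳ 1 (n∣m*n n {2}) ⟩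
  0 + n * 2 / 2       ≡⟨ m*n/n≡m n 2 ⟩
  n                   ∎
  where open ≡-Reasoning

nbParity-*-2 : ∀ y → nbParity (ℤ.- + 2 ℤ.* y) ≡ nbParity y
nbParity-*-2 (+ zero)  = refl
nbParity-*-2 (+ suc x) = trans (nbParity-step⁻ (2 * suc x))
  (cong₂ (λ d y → isOne d xor nbParity (+ y)) ([2*n]%2≡0 (suc x)) half)
  where
  half : (2 * suc x + 2 * suc x % 2) / 2 ≡ suc x
  half = trans (cong (λ r → (2 * suc x + r) / 2) ([2*n]%2≡0 (suc x)))
               (trans (cong (_/ 2) (+-identityʳ (2 * suc x))) ([2*n]/2≡n (suc x)))
nbParity-*-2 -[1+ x ]  = trans (nbParity-step⁺ (2 * suc x))
  (cong₂ (λ d y → isOne d xor nbParity (ℤ.- + y)) ([2*n]%2≡0 (suc x)) ([2*n]/2≡n (suc x)))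

nbParity-1-2* : ∀ y → nbParity (+ 1 ℤ.+ ℤ.- + 2 ℤ.* y) ≡ not (nbParity y)
nbParity-1-2* (+ zero)  = refl
-- 1 − 2(x + 1) = −(2x + 1)
nbParity-1-2* (+ suc x) = trans (cong (λ k → nbParity (+ 1 ℤ.+ -[1+ k ])) (+-suc x (x + 0)))
  (trans (nbParity-step⁻ (suc (2 * x)))
    (cong₂ (λ d y → isOne d xor nbParity (+ y)) ([1+2*n]%2≡1 x) half))
  where
  half : (suc (2 * x) + suc (2 * x) % 2) / 2 ≡ suc x
  half = trans (cong (λ r → (suc (2 * x) + r) / 2) ([1+2*n]%2≡1 x))
               (trans (cong (_/ 2) (+-comm (suc (2 * x)) 1))
               (trans (2+n/2≡1+n/2 (2 * x)) (cong suc ([2*n]/2≡n x))))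
nbParity-1-2* -[1+ x ]  = trans (nbParity-step⁺ (suc (2 * suc x)))
  (cong₂ (λ d y → isOne d xor nbParity (ℤ.- + y)) ([1+2*n]%2≡1 (suc x)) ([1+2*n]/2≡n (suc x)))

-- Parity of the two lowest negabinary digits of r + 4q for r < 4; they are the binary digits of r.
lowParity : ℕ → Bool
lowParity 1 = true
lowParity 2 = true
lowParity _ = false

-- i = d₀ − 2 d₁ + 4 · quot₄ i, where d₀ d₁ are the two lowest negabinary digits of i.
quot₄ : ℕ → ℕ
quot₄ i = (2 + i) / 4

g[r+q*4]≡nbParity : ∀ r q {z} → + r ℤ.+ + q ℤ.* + 4 ≡ z → g (r + q * 4) ≡ nbParity z
g[r+q*4]≡nbParity r q eq = trans (g≡nbParity (r + q * 4))
  (cong nbParity (trans (pos-+ r (q * 4)) (trans (cong (λ x → + r ℤ.+ x) (pos-* q 4)) eq)))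

g-digits : ∀ r q → r < 4 → g (r + q * 4) ≡ lowParity r xor g ((2 + r) / 4 + q)
g-digits 0 q _ = begin
  g (q * 4)                                                 ≡⟨ g[r+q*4]≡nbParity 0 q (digits₀ (+ q)) ⟩
  nbParity (ℤ.- + 2 ℤ.* (ℤ.- + 2 ℤ.* + q))                  ≡⟨ nbParity-*-2 (ℤ.- + 2 ℤ.* + q) ⟩
  nbParity (ℤ.- + 2 ℤ.* + q)                                ≡⟨ nbParity-*-2 (+ q) ⟩
  nbParity (+ q)                                            ≡⟨ sym (g≡nbParity q) ⟩
  g q                                                       ∎
  where
  open ≡-Reasoning
  digits₀ : ∀ x → + 0 ℤ.+ x ℤ.* + 4 ≡ ℤ.- + 2 ℤ.* (ℤ.- + 2 ℤ.* x)
  digits₀ = solve-∀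
g-digits 1 q _ = begin
  g (1 + q * 4)                                             ≡⟨ g[r+q*4]≡nbParity 1 q (digits₁ (+ q)) ⟩
  nbParity (+ 1 ℤ.+ ℤ.- + 2 ℤ.* (ℤ.- + 2 ℤ.* + q))          ≡⟨ nbParity-1-2* (ℤ.- + 2 ℤ.* + q) ⟩
  not (nbParity (ℤ.- + 2 ℤ.* + q))                          ≡⟨ cong not (nbParity-*-2 (+ q)) ⟩
  not (nbParity (+ q))                                      ≡⟨ cong not (sym (g≡nbParity q)) ⟩
  not (g q)                                                 ∎
  where
  open ≡-Reasoning
  digits₁ : ∀ x → + 1 ℤ.+ x ℤ.* + 4 ≡ + 1 ℤ.+ ℤ.- + 2 ℤ.* (ℤ.- + 2 ℤ.* x)
  digits₁ = solve-∀
g-digits 2 q _ = begin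
  g (2 + q * 4)                                             ≡⟨ g[r+q*4]≡nbParity 2 q (digits₂ (+ q)) ⟩
  nbParity (ℤ.- + 2 ℤ.* (+ 1 ℤ.+ ℤ.- + 2 ℤ.* + suc q))      ≡⟨ nbParity-*-2 (+ 1 ℤ.+ ℤ.- + 2 ℤ.* + suc q) ⟩
  nbParity (+ 1 ℤ.+ ℤ.- + 2 ℤ.* + suc q)                    ≡⟨ nbParity-1-2* (+ suc q) ⟩
  not (nbParity (+ suc q))                                  ≡⟨ cong not (sym (g≡nbParity (suc q))) ⟩
  not (g (suc q))                                           ∎
  where
  open ≡-Reasoning
  digits₂ : ∀ x → + 2 ℤ.+ x ℤ.* + 4 ≡ ℤ.- + 2 ℤ.* (+ 1 ℤ.+ ℤ.- + 2 ℤ.* (+ 1 ℤ.+ x))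
  digits₂ = solve-∀
g-digits 3 q _ = begin
  g (3 + q * 4)                                             ≡⟨ g[r+q*4]≡nbParity 3 q (digits₃ (+ q)) ⟩
  nbParity (+ 1 ℤ.+ ℤ.- + 2 ℤ.* (+ 1 ℤ.+ ℤ.- + 2 ℤ.* + suc q))
    ≡⟨ nbParity-1-2* (+ 1 ℤ.+ ℤ.- + 2 ℤ.* + suc q) ⟩
  not (nbParity (+ 1 ℤ.+ ℤ.- + 2 ℤ.* + suc q))              ≡⟨ cong not (nbParity-1-2* (+ suc q)) ⟩
  not (not (nbParity (+ suc q)))                            ≡⟨ not-involutive _ ⟩
  nbParity (+ suc q)                                        ≡⟨ sym (g≡nbParity (suc q)) ⟩
  g (suc q)                                                 ∎
  where
  open ≡-Reasoning
  digits₃ : ∀ x → + 3 ℤ.+ x ℤ.* + 4 ≡ + 1 ℤ.+ ℤ.- + 2 ℤ.* (+ 1 ℤ.+ ℤ.- + 2 ℤ.* (+ 1 ℤ.+ x))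
  digits₃ = solve-∀
g-digits (suc (suc (suc (suc _)))) _ (s≤s (s≤s (s≤s (s≤s ()))))

xor-left-comm : ∀ a b c → a xor (b xor c) ≡ b xor (a xor c)
xor-left-comm false _     _ = refl
xor-left-comm true  false _ = refl
xor-left-comm true  true  _ = refl

quot₄-+* : ∀ i q → quot₄ (i + q * 4) ≡ quot₄ i + q
quot₄-+* i q = trans (+-distrib-/-∣ʳ (2 + i) (n∣m*n q {4})) (cong (λ x → quot₄ i + x) (m*n/n≡m q 4))

quot₄-mono : ∀ {i j} → i ≤ j → quot₄ i ≤ quot₄ j
quot₄-mono i≤j = /-monoˡ-≤ 4 (s≤s (s≤s i≤j))

quot₄-≤ : ∀ N {i} → i ≤ N * 4 → quot₄ i ≤ N
quot₄-≤ N i≤4N = ≤-trans (quot₄-mono i≤4N) (≤-reflexive (quot₄-+* 0 N))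

g-quarter : ∀ i → g i ≡ lowParity (i % 4) xor g (quot₄ i)
g-quarter i = begin
  g i                                    ≡⟨ cong g i≡r+q*4 ⟩
  g (r + q * 4)                          ≡⟨ g-digits r q (m%n<n i 4) ⟩
  lowParity r xor g (quot₄ r + q)        ≡⟨ cong (λ x → lowParity r xor g x) (sym (quot₄-+* r q)) ⟩
  lowParity r xor g (quot₄ (r + q * 4))  ≡⟨ cong (λ x → lowParity r xor g (quot₄ x)) (sym i≡r+q*4) ⟩
  lowParity r xor g (quot₄ i)            ∎
  where
  open ≡-Reasoning
  r = i % 4
  q = i / 4
  i≡r+q*4 : i ≡ r + q * 4
  i≡r+q*4 = m≡m%n+[m/n]*n i 4

g-shift : ∀ N i b → g (N + quot₄ i) ≡ b xor g (quot₄ i) → g (N * 4 + i) ≡ b xor g i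
g-shift N i b hyp = begin
  g (N * 4 + i)                                           ≡⟨ g-quarter (N * 4 + i) ⟩
  lowParity ((N * 4 + i) % 4) xor g (quot₄ (N * 4 + i))   ≡⟨ cong₂ (λ r x → lowParity r xor g x) low-shift quot-shift ⟩
  lowParity (i % 4) xor g (N + quot₄ i)                   ≡⟨ cong (lowParity (i % 4) xor_) hyp ⟩
  lowParity (i % 4) xor (b xor g (quot₄ i))               ≡⟨ xor-left-comm (lowParity (i % 4)) b _ ⟩
  b xor (lowParity (i % 4) xor g (quot₄ i))               ≡⟨ cong (b xor_) (sym (g-quarter i)) ⟩
  b xor g i                                               ∎
  where
  open ≡-Reasoning
  low-shift : (N * 4 + i) % 4 ≡ i % 4
  low-shift = trans (cong (_% 4) (+-comm (N * 4) i)) ([m+kn]%n≡m%n i N 4)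
  quot-shift : quot₄ (N * 4 + i) ≡ N + quot₄ i
  quot-shift = trans (cong quot₄ (+-comm (N * 4) i)) (trans (quot₄-+* i N) (+-comm (quot₄ i) N))

g-block-induction : (N : ℕ → ℕ) (P : ℕ → ℕ → Set) (b : Bool) →
  (∀ m → N (suc m) ≡ N m * 4) →
  (∀ {m i} → P (suc m) i → P m (quot₄ i)) →
  (∀ i → P 0 i → g (N 0 + i) ≡ b xor g i) →
  ∀ m i → P m i → g (N m + i) ≡ b xor g i
g-block-induction N P b N-step P-step base zero    i p = base i p
g-block-induction N P b N-step P-step base (suc m) i p rewrite N-step m =
  g-shift (N m) i b (g-block-induction N P b N-step P-step base m (quot₄ i) (P-step p))

-- (4 ^ m ∸ 1) / 3, written with m ones in base 4
repunit : ℕ → ℕ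
repunit zero    = 0
repunit (suc m) = 1 + repunit m * 4

g[4^m+i]≡¬g[i] : ∀ m i → i ≤ 4 ^ m → g (4 ^ m + i) ≡ not (g i)
g[4^m+i]≡¬g[i] = g-block-induction (4 ^_) (λ m i → i ≤ 4 ^ m) true
  (λ m → *-comm 4 (4 ^ m))
  (λ {m} {i} i≤ → quot₄-≤ (4 ^ m) (subst (i ≤_) (*-comm 4 (4 ^ m)) i≤))
  λ where 0 _ → refl
          1 _ → refl
          (suc (suc _)) (s≤s ())

2*4^[1+m]≡2*4^m*4 : ∀ m → 2 * 4 ^ suc m ≡ 2 * 4 ^ m * 4
2*4^[1+m]≡2*4^m*4 m = lemma (4 ^ m)
  where
  lemma : ∀ x → 2 * (4 * x) ≡ 2 * x * 4
  lemma = solve-∀ℕ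

g[2*4^m+i]≡g[i] : ∀ m i → i ≤ repunit (suc m) → g (2 * 4 ^ m + i) ≡ g i
g[2*4^m+i]≡g[i] = g-block-induction (λ m → 2 * 4 ^ m) (λ m i → i ≤ repunit (suc m)) false
  2*4^[1+m]≡2*4^m*4
  (λ {m} i≤ → ≤-trans (quot₄-mono i≤) (≤-reflexive (quot₄-+* 1 (repunit (suc m)))))
  λ where 0 _ → refl
          1 _ → refl
          (suc (suc _)) (s≤s ())

g[2*4^m+i]≡¬g[i] : ∀ m i → repunit (suc m) < i → i ≤ 2 * 4 ^ m → g (2 * 4 ^ m + i) ≡ not (g i)
g[2*4^m+i]≡¬g[i] m i a<i i≤ = g-block-induction (λ m → 2 * 4 ^ m)
  (λ m i → repunit (suc m) < i × i ≤ 2 * 4 ^ m) true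
  2*4^[1+m]≡2*4^m*4
  (λ {m} {i} (a<i , i≤) →
      ≤-trans (≤-reflexive (sym (quot₄-+* 2 (repunit (suc m))))) (quot₄-mono a<i)
    , quot₄-≤ (2 * 4 ^ m) (subst (i ≤_) (2*4^[1+m]≡2*4^m*4 m) i≤))
  (λ where 0 (() , _)
           1 (s≤s () , _)
           2 _ → refl
           (suc (suc (suc _))) (_ , s≤s (s≤s ())))
  m i (a<i , i≤)

module _ {A : Set} where

  applyUpTo-+ : ∀ (f : ℕ → A) m n →
                applyUpTo f (m + n) ≡ applyUpTo f m ++ applyUpTo (λ i → f (m + i)) n
  applyUpTo-+ f zero    n = refl
  applyUpTo-+ f (suc m) n = cong (f 0 ∷_) (applyUpTo-+ (λ i → f (suc i)) m n)

  applyUpTo-cong : ∀ {f h : ℕ → A} n → (∀ {i} → i < n → f i ≡ h i) → applyUpTo f n ≡ applyUpTo h n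
  applyUpTo-cong zero    _  = refl
  applyUpTo-cong (suc n) eq = cong₂ _∷_ (eq z<s) (applyUpTo-cong n (λ i<n → eq (s<s i<n)))

  take-applyUpTo-+ : ∀ (f : ℕ → A) m n → take m (applyUpTo f (m + n)) ≡ applyUpTo f m
  take-applyUpTo-+ f zero    n = refl
  take-applyUpTo-+ f (suc m) n = cong (f 0 ∷_) (take-applyUpTo-+ (λ i → f (suc i)) m n)

  drop-applyUpTo-+ : ∀ (f : ℕ → A) m n → drop m (applyUpTo f (m + n)) ≡ applyUpTo (λ i → f (m + i)) n
  drop-applyUpTo-+ f zero    n = refl
  drop-applyUpTo-+ f (suc m) n = drop-applyUpTo-+ (λ i → f (suc i)) m n

  applyUpTo-double : ∀ (f : ℕ → A) n → applyUpTo f (2 * n) ≡ applyUpTo f n ++ applyUpTo (λ i → f (n + i)) n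
  applyUpTo-double f n = trans (cong (λ k → applyUpTo f (n + k)) (+-identityʳ n)) (applyUpTo-+ f n n)

complementLast-applyUpTo : ∀ (f : ℕ → Bool) c j →
  complementLast j (applyUpTo f (c + j)) ≡ applyUpTo f c ++ complement (applyUpTo (λ i → f (c + i)) j)
complementLast-applyUpTo f c j = begin
  take (length w ∸ j) w ++ complement (drop (length w ∸ j) w)  ≡⟨ cong (λ k → take k w ++ complement (drop k w)) length∸j ⟩
  take c w ++ complement (drop c w)                            ≡⟨ cong₂ _++_ (take-applyUpTo-+ f c j) (cong complement (drop-applyUpTo-+ f c j)) ⟩
  applyUpTo f c ++ complement (applyUpTo (λ i → f (c + i)) j)  ∎
  where
  open ≡-Reasoning
  w = applyUpTo f (c + j)
  length∸j : length w ∸ j ≡ c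
  length∸j = trans (cong (_∸ j) (length-applyUpTo f (c + j))) (m+n∸n≡m c j)

4^m≡1+repunit*3 : ∀ m → 4 ^ m ≡ 1 + repunit m * 3
4^m≡1+repunit*3 zero    = refl
4^m≡1+repunit*3 (suc m) = trans (cong (4 *_) (4^m≡1+repunit*3 m)) (lemma (repunit m))
  where
  lemma : ∀ a → 4 * (1 + a * 3) ≡ 1 + (1 + a * 4) * 3
  lemma = solve-∀ℕ

2*[4^m∸1]/3≡2*repunit : ∀ m → 2 * (4 ^ m ∸ 1) / 3 ≡ 2 * repunit m
2*[4^m∸1]/3≡2*repunit m = begin
  2 * (4 ^ m ∸ 1) / 3           ≡⟨ cong (λ x → 2 * (x ∸ 1) / 3) (4^m≡1+repunit*3 m) ⟩
  2 * (repunit m * 3) / 3       ≡⟨ cong (_/ 3) (sym (*-assoc 2 (repunit m) 3)) ⟩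
  2 * repunit m * 3 / 3         ≡⟨ m*n/n≡m (2 * repunit m) 3 ⟩
  2 * repunit m                 ∎
  where open ≡-Reasoning

2*4^m≡1+repunit[1+m]+2*repunit : ∀ m → 2 * 4 ^ m ≡ suc (repunit (suc m)) + 2 * repunit m
2*4^m≡1+repunit[1+m]+2*repunit m = trans (cong (2 *_) (4^m≡1+repunit*3 m)) (lemma (repunit m))
  where
  lemma : ∀ a → 2 * (1 + a * 3) ≡ suc (1 + a * 4) + 2 * a
  lemma = solve-∀ℕ

block-complement : ∀ m → applyUpTo g (2 * 4 ^ m) ≡ applyUpTo g (4 ^ m) ++ complement (applyUpTo g (4 ^ m))
block-complement m = trans (applyUpTo-double g K) (cong (applyUpTo g K ++_)
  (trans (applyUpTo-cong K (λ {i} i<K → g[4^m+i]≡¬g[i] m i (<⇒≤ i<K))) (sym (map-applyUpTo g not K))))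
  where K = 4 ^ m

block-complementLast : ∀ m → applyUpTo g (2 * (2 * 4 ^ m)) ≡
  applyUpTo g (2 * 4 ^ m) ++ complementLast (2 * (4 ^ m ∸ 1) / 3) (applyUpTo g (2 * 4 ^ m))
block-complementLast m = begin
  applyUpTo g (2 * L)                                      ≡⟨ applyUpTo-double g L ⟩
  applyUpTo g L ++ applyUpTo (λ i → g (L + i)) L           ≡⟨ cong (applyUpTo g L ++_) (subst upper-half (sym L≡c+j) upper) ⟩
  applyUpTo g L ++ complementLast j (applyUpTo g L)        ≡⟨ cong (λ k → applyUpTo g L ++ complementLast k (applyUpTo g L)) (sym (2*[4^m∸1]/3≡2*repunit m)) ⟩
  applyUpTo g L ++ complementLast (2 * (4 ^ m ∸ 1) / 3) (applyUpTo g L) ∎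
  where
  open ≡-Reasoning
  L = 2 * 4 ^ m
  c = suc (repunit (suc m))
  j = 2 * repunit m
  L≡c+j : L ≡ c + j
  L≡c+j = 2*4^m≡1+repunit[1+m]+2*repunit m
  upper-half : ℕ → Set
  upper-half n = applyUpTo (λ i → g (L + i)) n ≡ complementLast j (applyUpTo g n)
  upper : upper-half (c + j)
  upper = begin
    applyUpTo (λ i → g (L + i)) (c + j)                                    ≡⟨ applyUpTo-+ (λ i → g (L + i)) c j ⟩
    applyUpTo (λ i → g (L + i)) c ++ applyUpTo (λ i → g (L + (c + i))) j   ≡⟨ cong₂ _++_ (applyUpTo-cong c kept)
                                                                                (trans (applyUpTo-cong j flipped) (sym (map-applyUpTo _ not j))) ⟩
    applyUpTo g c ++ complement (applyUpTo (λ i → g (c + i)) j)            ≡⟨ sym (complementLast-applyUpTo g c j) ⟩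
    complementLast j (applyUpTo g (c + j))                                 ∎
    where
    kept : ∀ {i} → i < c → g (L + i) ≡ g i
    kept {i} i<c = g[2*4^m+i]≡g[i] m i (≤-pred i<c)
    flipped : ∀ {i} → i < j → g (L + (c + i)) ≡ not (g (c + i))
    flipped {i} i<j = g[2*4^m+i]≡¬g[i] m (c + i) (m≤m+n c i)
      (≤-trans (<⇒≤ (+-monoʳ-< c i<j)) (≤-reflexive (sym L≡c+j)))

2^[2*m]≡4^m : ∀ m → 2 ^ (2 * m) ≡ 4 ^ m
2^[2*m]≡4^m m = sym (^-*-assoc 2 2 m)

theorem4 : (G 0 ≡ false ∷ [])
    × (∀ m → G (suc (2 * m)) ≡ G (2 * m) ++ complement (G (2 * m)))
    × (∀ m → G (suc (suc (2 * m))) ≡ G (suc (2 * m)) ++ complementLast ((2 * (2 ^ (2 * m) ∸ 1)) / 3) (G (suc (2 * m))))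
theorem4 = refl
  , (λ m → subst (λ K → applyUpTo g (2 * K) ≡ applyUpTo g K ++ complement (applyUpTo g K))
                 (sym (2^[2*m]≡4^m m)) (block-complement m))
  , (λ m → subst (λ K → applyUpTo g (2 * (2 * K)) ≡
                        applyUpTo g (2 * K) ++ complementLast (2 * (K ∸ 1) / 3) (applyUpTo g (2 * K)))
                 (sym (2^[2*m]≡4^m m)) (block-complementLast m))
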